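{- For any graphs $G$ and $H$ and any integer $q\ge 0$, \[ \max_{s+t=q}\big(Z_s(G)+Z_t(H)\big)\le Z_q(G\sqcup H), \] where $G\sqcup H$ denotes the disjoint union of $G$ and $H$ and the maximum is over nonnegative integers $s,t$ with $s+t=q$.
   Context: Let $G=(V,E)$ be a graph whose vertices are colored black or white. The color change rule: if a black vertex has exactly one white neighbor, that white neighbor is changed to black. For a subset $W\subseteq V$, $G[W]$ is the induced subgraph on $W$. The $Z_q$-forcing game on $G$ is played by two players, Black (who has tokens) and White; initially all vertices are white, and Black repeatedly applies one of the following options until all vertices are black: (1) change any white vertex to black at the cost of one token; (2) apply the color change rule on the whole graph $G$ at no cost; (3) letting $B$ be the set of black vertices and $W_1,\ldots,W_k$ the vertex sets of the connected components of $G[V\setminus B]$, Black announces a set $S$ of at least $q+1$ of the $W_i$, White returns a nonempty subset $T=\{W_{i_1},\ldots,W_{i_\ell}\}\subseteq S$, and Black applies the color change rule on $G[B\cup W_{i_1}\cup\cdots\cup W_{i_\ell}]$ at no cost. $Z_q(G)$ is the minimum number of tokens Black must spend to turn all vertices black, regardless of White's play. -}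

module Defs where

open import Data.Nat using (ℕ; zero; suc; _+_; _≤_)
open import Data.Fin using (Fin; splitAt; _≟_)
open import Data.Bool using (Bool; true; false)
open import Data.Sum using (_⊎_; inj₁; inj₂)
open import Data.Product using (Σ; _×_; _,_; ∃)
open import Relation.Binary.PropositionalEquality using (_≡_; _≢_)
open import Data.Unit using (⊤)
open import Relation.Nullary using (¬_; yes; no)

record Graph : Set where
  field
    n     : ℕ
    adj   : Fin n → Fin n → Bool
    sym   : ∀ u v → adj u v ≡ adj v u
    irrefl : ∀ v → adj v v ≡ false

open Graph public

⊔-adj : (G H : Graph) → Fin (n G + n H) → Fin (n G + n H) → Bool
⊔-adj G H u v with splitAt (n G) u | splitAt (n G) v
... | inj₁ a | inj₁ b = adj G a b
... | inj₂ a | inj₂ b = adj H a b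
... | inj₁ _ | inj₂ _ = false
... | inj₂ _ | inj₁ _ = false

⊔-sym : (G H : Graph) → ∀ u v → ⊔-adj G H u v ≡ ⊔-adj G H v u
⊔-sym G H u v with splitAt (n G) u | splitAt (n G) v
... | inj₁ a | inj₁ b = sym G a b
... | inj₂ a | inj₂ b = sym H a b
... | inj₁ _ | inj₂ _ = Relation.Binary.PropositionalEquality.refl
... | inj₂ _ | inj₁ _ = Relation.Binary.PropositionalEquality.refl

⊔-irrefl : (G H : Graph) → ∀ v → ⊔-adj G H v v ≡ false
⊔-irrefl G H v with splitAt (n G) v
... | inj₁ a = irrefl G a
... | inj₂ a = irrefl H a

_⊔_ : Graph → Graph → Graph
G ⊔ H = record { n = n G + n H ; adj = ⊔-adj G H ; sym = ⊔-sym G H ; irrefl = ⊔-irrefl G H }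

-- Colourings: B v ≡ true means v is black.

Colouring : Graph → Set
Colouring G = Fin (n G) → Bool

allWhite : (G : Graph) → Colouring G
allWhite G _ = false

blacken : (G : Graph) → Colouring G → Fin (n G) → Colouring G
blacken G B v w with w ≟ v
... | yes _ = true
... | no  _ = B w

-- Color change rule applied in the induced subgraph G[U] (U ⊇ black set):
-- black u ∈ U forces v, where v is the unique white neighbour of u inside U.
record ForceIn (G : Graph) (U : Fin (n G) → Set) (B : Colouring G)
               (u v : Fin (n G)) : Set where
  field
    u-black : B u ≡ true
    v-inU   : U v
    v-white : B v ≡ false
    uv-adj  : adj G u v ≡ true
    unique  : ∀ w → U w → B w ≡ false → adj G u w ≡ true → w ≡ v

data ForcesIn (G : Graph) (U : Fin (n G) → Set) :
              Colouring G → Colouring G → Set where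
  stop : ∀ {B} → ForcesIn G U B B
  step : ∀ {B B'} u v → ForceIn G U B u v →
         ForcesIn G U (blacken G B v) B' → ForcesIn G U B B'

data WhitePath (G : Graph) (B : Colouring G) : Fin (n G) → Fin (n G) → Set where
  here : ∀ {v} → B v ≡ false → WhitePath G B v v
  next : ∀ {u w v} → B u ≡ false → adj G u w ≡ true →
         WhitePath G B w v → WhitePath G B u v

-- The vertex set B ∪ W_{i1} ∪ ... ∪ W_{iℓ}, where the components are given
-- by representatives reps i for the selected indices (sel i ≡ true).
UnionSel : (G : Graph) (B : Colouring G) {m : ℕ} →
           (Fin m → Fin (n G)) → (Fin m → Bool) → Fin (n G) → Set
UnionSel G B {m} reps sel v =
  (B v ≡ true) ⊎ (Σ (Fin m) λ i → (sel i ≡ true) × WhitePath G B (reps i) v)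

-- Winning positions for Black in the Z_q-forcing game.
-- Win q G B k : from the colouring B, Black can turn all vertices black
-- spending at most k tokens, regardless of White's play.

data Win (q : ℕ) (G : Graph) : Colouring G → ℕ → Set where
  done  : ∀ {B k} → (∀ v → B v ≡ true) → Win q G B k
  token : ∀ {B k} v → B v ≡ false →
          Win q G (blacken G B v) k → Win q G B (suc k)
  force : ∀ {B k} u v → ForceIn G (λ _ → ⊤) B u v →
          Win q G (blacken G B v) k → Win q G B k
  -- option (3): Black announces m ≥ q+1 distinct components of G[V ∖ B]
  -- (given by white representatives in pairwise distinct components);
  -- for every nonempty selection T chosen by White, Black applies the color
  -- change rule in G[B ∪ ⋃ T] and continues winning.
  game  : ∀ {B k} (m : ℕ) → suc q ≤ m → (reps : Fin m → Fin (n G)) →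
          (∀ i → B (reps i) ≡ false) →
          (∀ i j → i ≢ j → ¬ WhitePath G B (reps i) (reps j)) →
          ((sel : Fin m → Bool) → (∃ λ i → sel i ≡ true) →
             Σ (Colouring G) λ B' →
               ForcesIn G (UnionSel G B reps sel) B B' × Win q G B' k) →
          Win q G B k

IsZ : ℕ → Graph → ℕ → Set
IsZ q G k = Win q G (allWhite G) k × (∀ j → Win q G (allWhite G) j → k ≤ j)

-- Induct on Black's winning strategy for the union X ⊔ Y in the Z_(s+t)-game, showing that it
-- restricts to a Z_s-strategy on X and a Z_t-strategy on Y whose token counts add up to at most
-- the tokens spent on the union.  Tokens and forces act on one side only, as no edge crosses.
-- When Black announces s + t + 1 components, by pigeonhole s + 1 of them lie in X (or t + 1 in
-- Y); the X-strategy announces those, and White's choice among them is answered by replaying it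
-- in the union.  The Y-strategy must not depend on that choice, so it is taken from the choice
-- for which Y needs fewest tokens; every other choice then leaves X at least as many tokens.
module Submission where

open import Defs
open import Data.Bool using (Bool; true; false)
import Data.Bool as Bool
open import Data.Fin using (Fin; zero; suc; splitAt; lift; _↑ˡ_; _↑ʳ_; _≟_)
open import Data.Fin.Properties
  using (any?; suc-injective; lift-injective; ↑ˡ-injective; ↑ʳ-injective;
         splitAt-↑ˡ; splitAt-↑ʳ; splitAt⁻¹-↑ˡ; splitAt⁻¹-↑ʳ)
open import Data.Nat using (ℕ; zero; suc; _+_; _∸_; _≤_; _<_; z≤n; s≤s; _≤?_)
open import Data.Nat.Properties
  using (≤-refl; ≤-trans; ≤-reflexive; ≤-pred; ≰⇒>; <⇒≤; +-suc; +-comm; +-mono-≤;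
         ∸-monoʳ-≤; m∸n+n≡m; m+n≤o⇒n≤o; m+n≤o⇒m≤o∸n)
open import Data.Product using (Σ; ∃; ∃₂; _×_; _,_; proj₁; proj₂)
open import Data.Sum using (_⊎_; inj₁; inj₂)
import Data.Sum as Sum
open import Data.Unit using (⊤)
open import Data.Vec.Functional using (_∷_; tail)
open import Data.Vec.Functional.Properties using (∷-cong)
open import Function using (_∘_)
open import Function.Definitions using (Injective)
open import Relation.Binary.PropositionalEquality using (_≡_; _≢_; _≗_; refl; trans; cong; subst; subst₂)
import Relation.Binary.PropositionalEquality as ≡
open import Relation.Nullary using (¬_; yes; no; contradiction)
open import Relation.Unary using (_⊆_)

blacken-self : (G : Graph) (B : Colouring G) (v : Fin (n G)) → blacken G B v v ≡ true
blacken-self G B v with v ≟ v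
... | yes _  = refl
... | no v≢v = contradiction refl v≢v

blacken-other : (G : Graph) (B : Colouring G) {v w : Fin (n G)} → w ≢ v → blacken G B v w ≡ B w
blacken-other G B {v} {w} w≢v with w ≟ v
... | yes w≡v = contradiction w≡v w≢v
... | no _    = refl

win-mono : ∀ {q G B k k'} → Win q G B k → k ≤ k' → Win q G B k'
win-mono (done all)                   _        = done all
win-mono (token v white W)            (s≤s le) = token v white (win-mono W le)
win-mono (force u v F W)              le       = force u v F (win-mono W le)
win-mono (game m m>q reps white distinct moves) le =
  game m m>q reps white distinct λ sel nonempty →
    let B' , F , W = moves sel nonempty in B' , F , win-mono W le

ForcesIn-resp : ∀ {G} {U U' : Fin (n G) → Set} {B B'} → U ⊆ U' → U' ⊆ U →
                ForcesIn G U B B' → ForcesIn G U' B B'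
ForcesIn-resp U⊆U' U'⊆U stop = stop
ForcesIn-resp U⊆U' U'⊆U (step u v F rest) = step u v
  (record { u-black = u-black ; v-inU = U⊆U' v-inU ; v-white = v-white ; uv-adj = uv-adj
          ; unique = λ w → unique w ∘ U'⊆U })
  (ForcesIn-resp U⊆U' U'⊆U rest)
  where open ForceIn F

UnionSel-resp : ∀ {G B m} {reps : Fin m → Fin (n G)} {sel sel'} →
                sel ≗ sel' → UnionSel G B reps sel ⊆ UnionSel G B reps sel'
UnionSel-resp sel≗sel' (inj₁ black)                  = inj₁ black
UnionSel-resp sel≗sel' (inj₂ (i , selected , path)) = inj₂ (i , trans (≡.sym (sel≗sel' i)) selected , path)

Reply : ∀ q (G : Graph) (B : Colouring G) {m} → (Fin m → Fin (n G)) → (Fin m → Bool) → ℕ → Set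
Reply q G B reps sel k = Σ (Colouring G) λ B' → ForcesIn G (UnionSel G B reps sel) B B' × Win q G B' k

Reply-mono : ∀ {q G B m} {reps : Fin m → Fin (n G)} {sel k k'} →
             k ≤ k' → Reply q G B reps sel k → Reply q G B reps sel k'
Reply-mono k≤k' (B' , F , W) = B' , F , win-mono W k≤k'

Reply-resp : ∀ {q G B m} {reps : Fin m → Fin (n G)} {sel sel' k} →
             sel ≗ sel' → Reply q G B reps sel k → Reply q G B reps sel' k
Reply-resp sel≗sel' (B' , F , W) =
  B' , ForcesIn-resp (UnionSel-resp sel≗sel') (UnionSel-resp (≡.sym ∘ sel≗sel')) F , W

∀-by-head : ∀ {m} {R : (Fin (suc m) → Bool) → Set} → (∀ {sel sel'} → sel ≗ sel' → R sel → R sel') →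
            (∀ sel → R (false ∷ sel)) → (∀ sel → R (true ∷ sel)) → ∀ sel → R sel
∀-by-head resp r₀ r₁ sel with sel zero in eq
... | false = resp (∷-cong (≡.sym eq) λ _ → refl) (r₀ (tail sel))
... | true  = resp (∷-cong (≡.sym eq) λ _ → refl) (r₁ (tail sel))

uniform-bound : ∀ m {P : ℕ → Set} {Q : (Fin m → Bool) → ℕ → Set} →
                (∀ sel {b b'} → b' ≤ b → Q sel b → Q sel b') →
                (∀ {sel sel'} → sel ≗ sel' → ∀ {b} → Q sel b → Q sel' b) →
                (∀ sel → ∃ λ b → P b × Q sel b) → ∃ λ b → P b × ∀ sel → Q sel b
uniform-bound zero    anti resp bound = let b , p , q = bound (λ ()) in b , p , λ _ → resp (λ ()) q
uniform-bound (suc m) anti resp bound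
  with uniform-bound m (anti ∘ (false ∷_)) (resp ∘ ∷-cong refl) (bound ∘ (false ∷_))
     | uniform-bound m (anti ∘ (true ∷_))  (resp ∘ ∷-cong refl) (bound ∘ (true ∷_))
... | b₀ , p₀ , q₀ | b₁ , p₁ , q₁ with b₀ ≤? b₁
... | yes b₀≤b₁ = b₀ , p₀ , ∀-by-head (λ e → resp e) q₀ (anti _ b₀≤b₁ ∘ q₁)
... | no  b₀≰b₁ = b₁ , p₁ , ∀-by-head (λ e → resp e) (anti _ (<⇒≤ (≰⇒> b₀≰b₁)) ∘ q₀) q₁

Embedding : ∀ {m} → ℕ → (Fin m → Set) → Set
Embedding {m} k P = Σ (Fin k → Fin m) λ e → Injective _≡_ _≡_ e × ∀ j → P (e j)

embedding-one : ∀ {m} {P : Fin m → Set} {i} → P i → Embedding 1 P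
embedding-one {i = i} p = (λ _ → i) , (λ { {zero} {zero} _ → refl }) , λ _ → p

embedding-suc : ∀ {m k} {P : Fin (suc m) → Set} → Embedding k (P ∘ suc) → Embedding k P
embedding-suc (e , e-inj , pe) = suc ∘ e , e-inj ∘ suc-injective , pe

embedding-cons : ∀ {m k} {P : Fin (suc m) → Set} → P zero → Embedding k (P ∘ suc) → Embedding (suc k) P
embedding-cons {P = P} p₀ (e , e-inj , pe) = lift 1 e , lift-injective e e-inj 1 , p
  where
  p : ∀ j → P (lift 1 e j)
  p zero    = p₀
  p (suc j) = pe j

pigeonhole-⊎ : ∀ {m} s t {P Q : Fin m → Set} → s + t < m → (∀ i → P i ⊎ Q i) →
               Embedding (suc s) P ⊎ Embedding (suc t) Q
pigeonhole-⊎ {suc m} s t {P} {Q} s+t<m classify with classify zero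
... | inj₁ p with s | s+t<m
...   | zero  | _       = inj₁ (embedding-one {P = P} p)
...   | suc s | s≤s lt  = Sum.map (embedding-cons {P = P} p) (embedding-suc {P = Q})
                            (pigeonhole-⊎ s t lt (classify ∘ suc))
pigeonhole-⊎ {suc m} s t {P} {Q} s+t<m classify | inj₂ q with t
...   | zero  = inj₂ (embedding-one {P = Q} q)
...   | suc t = Sum.map (embedding-suc {P = P}) (embedding-cons {P = Q} q)
                  (pigeonhole-⊎ s t (≤-pred (subst (_< suc m) (+-suc s t) s+t<m)) (classify ∘ suc))

push : ∀ {k m} → (Fin k → Fin m) → (Fin k → Bool) → Fin m → Bool
push e sel i with any? (λ j → e j ≟ i)
... | yes (j , _) = sel j
... | no  _       = false

push-true : ∀ {k m} {e : Fin k → Fin m} {sel i} → push e sel i ≡ true → ∃ λ j → e j ≡ i × sel j ≡ true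
push-true {e = e} {sel} {i} pushed with any? (λ j → e j ≟ i)
... | yes (j , ej≡i) = j , ej≡i , pushed

push-image : ∀ {k m} {e : Fin k → Fin m} {sel} → Injective _≡_ _≡_ e → ∀ j → push e sel (e j) ≡ sel j
push-image {e = e} {sel} e-inj j with any? (λ j' → e j' ≟ e j)
... | yes (j' , ej'≡ej) = cong sel (e-inj ej'≡ej)
... | no  none          = contradiction (j , refl) none

record DisjointUnion (K X Y : Graph) : Set where
  field
    inl           : Fin (n X) → Fin (n K)
    inr           : Fin (n Y) → Fin (n K)
    inl-injective : Injective _≡_ _≡_ inl
    inr-injective : Injective _≡_ _≡_ inr
    inl-adj       : ∀ a c → adj K (inl a) (inl c) ≡ adj X a c
    inr-adj       : ∀ a c → adj K (inr a) (inr c) ≡ adj Y a c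
    no-cross      : ∀ a b → adj K (inl a) (inr b) ≡ false
    inl≢inr       : ∀ a b → inl a ≢ inr b
    cover         : ∀ u → (∃ λ a → u ≡ inl a) ⊎ (∃ λ b → u ≡ inr b)

  inl-inr-nonadjacent : ∀ a b → adj K (inl a) (inr b) ≢ true
  inl-inr-nonadjacent a b e = contradiction (trans (≡.sym e) (no-cross a b)) λ ()

open DisjointUnion

swap : ∀ {K X Y} → DisjointUnion K X Y → DisjointUnion K Y X
swap {K} D = record
  { inl = inr D ; inr = inl D
  ; inl-injective = inr-injective D ; inr-injective = inl-injective D
  ; inl-adj = inr-adj D ; inr-adj = inl-adj D
  ; no-cross = λ b a → trans (Graph.sym K (inr D b) (inl D a)) (no-cross D a b)
  ; inl≢inr = λ b a e → inl≢inr D a b (≡.sym e)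
  ; cover = Sum.swap ∘ cover D
  }

⊔-disjointUnion : (G H : Graph) → DisjointUnion (G ⊔ H) G H
⊔-disjointUnion G H = record
  { inl = _↑ˡ n H ; inr = n G ↑ʳ_
  ; inl-injective = ↑ˡ-injective (n H) _ _ ; inr-injective = ↑ʳ-injective (n G) _ _
  ; inl-adj = adj-↑ˡ ; inr-adj = adj-↑ʳ ; no-cross = adj-↑ˡ-↑ʳ
  ; inl≢inr = ↑ˡ≢↑ʳ ; cover = ↑ˡ-↑ʳ-cover
  }
  where
  adj-↑ˡ : ∀ a c → ⊔-adj G H (a ↑ˡ n H) (c ↑ˡ n H) ≡ adj G a c
  adj-↑ˡ a c rewrite splitAt-↑ˡ (n G) a (n H) | splitAt-↑ˡ (n G) c (n H) = refl

  adj-↑ʳ : ∀ a c → ⊔-adj G H (n G ↑ʳ a) (n G ↑ʳ c) ≡ adj H a c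
  adj-↑ʳ a c rewrite splitAt-↑ʳ (n G) (n H) a | splitAt-↑ʳ (n G) (n H) c = refl

  adj-↑ˡ-↑ʳ : ∀ a b → ⊔-adj G H (a ↑ˡ n H) (n G ↑ʳ b) ≡ false
  adj-↑ˡ-↑ʳ a b rewrite splitAt-↑ˡ (n G) a (n H) | splitAt-↑ʳ (n G) (n H) b = refl

  ↑ˡ≢↑ʳ : ∀ a b → a ↑ˡ n H ≢ n G ↑ʳ b
  ↑ˡ≢↑ʳ a b e = contradiction
    (trans (≡.sym (splitAt-↑ˡ (n G) a (n H))) (trans (cong (splitAt (n G)) e) (splitAt-↑ʳ (n G) (n H) b)))
    λ ()

  ↑ˡ-↑ʳ-cover : ∀ u → (∃ λ a → u ≡ a ↑ˡ n H) ⊎ (∃ λ b → u ≡ n G ↑ʳ b)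
  ↑ˡ-↑ʳ-cover u with splitAt (n G) u in eq
  ... | inj₁ a = inj₁ (a , ≡.sym (splitAt⁻¹-↑ˡ eq))
  ... | inj₂ b = inj₂ (b , ≡.sym (splitAt⁻¹-↑ʳ eq))

record WinsOnParts {K X Y : Graph} (ιX : Fin (n X) → Fin (n K)) (ιY : Fin (n Y) → Fin (n K))
                   (s t : ℕ) (B : Colouring K) (k : ℕ) : Set where
  field
    split : ∀ (BX : Colouring X) (BY : Colouring Y) → BX ≗ B ∘ ιX → BY ≗ B ∘ ιY →
            ∃₂ λ a b → a + b ≤ k × Win s X BX a × Win t Y BY b

open WinsOnParts

-- Indexed by the embeddings rather than by D itself, so that SplitWin (swap (swap D)) is SplitWin D.
SplitWin : ∀ {K X Y} → DisjointUnion K X Y → ℕ → ℕ → Colouring K → ℕ → Set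
SplitWin {K} {X} {Y} D = WinsOnParts {K} {X} {Y} (inl D) (inr D)

SplitWin-swap : ∀ {K X Y} (D : DisjointUnion K X Y) {s t B k} →
                SplitWin D s t B k → SplitWin (swap D) t s B k
SplitWin-swap _ {k = k} w .split BY BX BY≗B BX≗B =
  let a , b , a+b≤k , WX , WY = w .split BX BY BX≗B BY≗B
  in b , a , subst (_≤ k) (+-comm a b) a+b≤k , WY , WX

module _ {K X Y : Graph} (D : DisjointUnion K X Y) where

  blacken-inl : ∀ {B : Colouring K} {BX : Colouring X} → BX ≗ B ∘ inl D →
                ∀ c → blacken X BX c ≗ blacken K B (inl D c) ∘ inl D
  blacken-inl {B} BX≗B c a with a ≟ c
  ... | yes refl = ≡.sym (blacken-self K B (inl D a))
  ... | no  a≢c  = trans (BX≗B a) (≡.sym (blacken-other K B (a≢c ∘ inl-injective D)))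

  blacken-inl-on-inr : ∀ (B : Colouring K) c → blacken K B (inl D c) ∘ inr D ≗ B ∘ inr D
  blacken-inl-on-inr B c b = blacken-other K B (inl≢inr D c b ∘ ≡.sym)

  ForceIn-restrict : ∀ {U B} {BX : Colouring X} {a c} → BX ≗ B ∘ inl D →
                     ForceIn K U B (inl D a) (inl D c) → ForceIn X (U ∘ inl D) BX a c
  ForceIn-restrict {a = a} {c} BX≗B F = record
    { u-black = trans (BX≗B a) u-black
    ; v-inU   = v-inU
    ; v-white = trans (BX≗B c) v-white
    ; uv-adj  = trans (≡.sym (inl-adj D a c)) uv-adj
    ; unique  = λ w Uw white adjacent → inl-injective D
        (unique (inl D w) Uw (trans (≡.sym (BX≗B w)) white) (trans (inl-adj D a w) adjacent))
    }
    where open ForceIn F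

  WhitePath-inl : ∀ {B} {BX : Colouring X} → BX ≗ B ∘ inl D →
                  ∀ {a c} → WhitePath X BX a c → WhitePath K B (inl D a) (inl D c)
  WhitePath-inl BX≗B (here white)              = here (trans (≡.sym (BX≗B _)) white)
  WhitePath-inl BX≗B (next white adjacent path) =
    next (trans (≡.sym (BX≗B _)) white) (trans (inl-adj D _ _) adjacent) (WhitePath-inl BX≗B path)

  WhitePath-restrict : ∀ {B} {BX : Colouring X} → BX ≗ B ∘ inl D →
                       ∀ {a v} → WhitePath K B (inl D a) v → ∃ λ c → v ≡ inl D c × WhitePath X BX a c
  WhitePath-restrict BX≗B {a} (here white) = a , refl , here (trans (BX≗B a) white)
  WhitePath-restrict BX≗B {a} (next {w = w} white adjacent path) with cover D w
  ... | inj₂ (b , refl) = contradiction adjacent (inl-inr-nonadjacent D a b)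
  ... | inj₁ (c , refl) =
    let d , v≡d , path' = WhitePath-restrict BX≗B path
    in d , v≡d , next (trans (BX≗B a) white) (trans (≡.sym (inl-adj D a c)) adjacent) path'

  ForcesIn-restrict : ∀ {U} {B B' : Colouring K} → ForcesIn K U B B' →
                      (∀ b → U (inr D b) → B (inr D b) ≡ true) → ∀ {BX} → BX ≗ B ∘ inl D →
                      Σ (Colouring X) λ B'X → ForcesIn X (U ∘ inl D) BX B'X ×
                        B'X ≗ B' ∘ inl D × B' ∘ inr D ≗ B ∘ inr D
  ForcesIn-restrict stop _ BX≗B = _ , stop , BX≗B , λ _ → refl
  ForcesIn-restrict {B = B} (step u v F rest) U-black-on-inr BX≗B with cover D u | cover D v
  ... | _               | inj₂ (b , refl) =
    contradiction (trans (≡.sym (U-black-on-inr b (ForceIn.v-inU F))) (ForceIn.v-white F)) λ ()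
  ... | inj₂ (a , refl) | inj₁ (c , refl) =
    contradiction (ForceIn.uv-adj F) (inl-inr-nonadjacent (swap D) a c)
  ... | inj₁ (a , refl) | inj₁ (c , refl) =
    let B'X , FX , B'X≗B' , unchanged =
          ForcesIn-restrict rest (λ b Ub → trans (blacken-inl-on-inr B c b) (U-black-on-inr b Ub))
                            (blacken-inl BX≗B c)
    in B'X , step a c (ForceIn-restrict BX≗B F) FX , B'X≗B' ,
       λ b → trans (unchanged b) (blacken-inl-on-inr B c b)

  module _ {B : Colouring K} {m l} {reps : Fin m → Fin (n K)} {e : Fin l → Fin m} {g : Fin l → Fin (n X)}
           (reps∘e≗inl∘g : reps ∘ e ≗ inl D ∘ g) where

    UnionSel-push-restrict : ∀ {BX : Colouring X} {sel} → BX ≗ B ∘ inl D →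
                             UnionSel K B reps (push e sel) ∘ inl D ⊆ UnionSel X BX g sel
    UnionSel-push-restrict BX≗B {a} (inj₁ black) = inj₁ (trans (BX≗B a) black)
    UnionSel-push-restrict BX≗B {a} (inj₂ (i , pushed , path)) with push-true {e = e} {i = i} pushed
    ... | j , refl , selected =
      let c , inl-a≡inl-c , path' =
            WhitePath-restrict BX≗B (subst (λ u → WhitePath K B u _) (reps∘e≗inl∘g j) path)
      in inj₂ (j , selected , subst (WhitePath X _ (g j)) (≡.sym (inl-injective D inl-a≡inl-c)) path')

    UnionSel-push-extend : ∀ {BX : Colouring X} {sel} → BX ≗ B ∘ inl D → Injective _≡_ _≡_ e →
                           UnionSel X BX g sel ⊆ UnionSel K B reps (push e sel) ∘ inl D
    UnionSel-push-extend BX≗B e-inj {a} (inj₁ black) = inj₁ (trans (≡.sym (BX≗B a)) black)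
    UnionSel-push-extend BX≗B e-inj {a} (inj₂ (j , selected , path)) =
      inj₂ (e j , trans (push-image e-inj j) selected ,
            subst (λ u → WhitePath K B u _) (≡.sym (reps∘e≗inl∘g j)) (WhitePath-inl BX≗B path))

    UnionSel-push-inr : ∀ {sel} b → UnionSel K B reps (push e sel) (inr D b) → B (inr D b) ≡ true
    UnionSel-push-inr b (inj₁ black) = black
    UnionSel-push-inr b (inj₂ (i , pushed , path)) with push-true {e = e} {i = i} pushed
    ... | j , refl , _ =
      let c , inr-b≡inl-c , _ = WhitePath-restrict {BX = B ∘ inl D} (λ _ → refl)
                                  (subst (λ u → WhitePath K B u _) (reps∘e≗inl∘g j) path)
      in contradiction (≡.sym inr-b≡inl-c) (inl≢inr D c b)

    -- White's choice of X-components is replayed in the union; the forcing that follows stays inside X.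
    Reply-restrict : ∀ {s t k} {BX : Colouring X} {BY : Colouring Y} → BX ≗ B ∘ inl D → BY ≗ B ∘ inr D →
                     Injective _≡_ _≡_ e → ∀ sel →
                     (Σ (Colouring K) λ B' →
                        ForcesIn K (UnionSel K B reps (push e sel)) B B' × SplitWin D s t B' k) →
                     ∃ λ b → (b ≤ k × Win t Y BY b) × Reply s X BX g sel (k ∸ b)
    Reply-restrict {BY = BY} BX≗B BY≗B e-inj sel (B' , F , w) =
      let B'X , FX , B'X≗B' , unchanged = ForcesIn-restrict F UnionSel-push-inr BX≗B
          a , b , a+b≤k , WX , WY = w .split B'X BY B'X≗B' (λ y → trans (BY≗B y) (≡.sym (unchanged y)))
      in b , (m+n≤o⇒n≤o a a+b≤k , WY) ,
         B'X , ForcesIn-resp (UnionSel-push-restrict BX≗B) (UnionSel-push-extend BX≗B e-inj) FX ,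
         win-mono WX (m+n≤o⇒m≤o∸n a a+b≤k)

  SplitWin-tokenˡ : ∀ {s t B k a} → B (inl D a) ≡ false →
                    SplitWin D s t (blacken K B (inl D a)) k → SplitWin D s t B (suc k)
  SplitWin-tokenˡ {B = B} {a = a} white w .split BX BY BX≗B BY≗B =
    let a' , b' , a'+b'≤k , WX , WY =
          w .split (blacken X BX a) BY (blacken-inl BX≗B a)
                   (λ b → trans (BY≗B b) (≡.sym (blacken-inl-on-inr B a b)))
    in suc a' , b' , s≤s a'+b'≤k , token a (trans (BX≗B a) white) WX , WY

  SplitWin-forceˡ : ∀ {s t B k a c} → ForceIn K (λ _ → ⊤) B (inl D a) (inl D c) →
                    SplitWin D s t (blacken K B (inl D c)) k → SplitWin D s t B k
  SplitWin-forceˡ {B = B} {c = c} F w .split BX BY BX≗B BY≗B =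
    let a' , b' , a'+b'≤k , WX , WY =
          w .split (blacken X BX c) BY (blacken-inl BX≗B c)
                   (λ b → trans (BY≗B b) (≡.sym (blacken-inl-on-inr B c b)))
    in a' , b' , a'+b'≤k , force _ c (ForceIn-restrict BX≗B F) WX , WY

  SplitWin-announceˡ : ∀ {s t B k m} (reps : Fin m → Fin (n K)) →
    (∀ i → B (reps i) ≡ false) → (∀ i j → i ≢ j → ¬ WhitePath K B (reps i) (reps j)) →
    Embedding (suc s) (λ i → ∃ λ a → reps i ≡ inl D a) →
    ((sel : Fin m → Bool) → (∃ λ i → sel i ≡ true) →
       Σ (Colouring K) λ B' → ForcesIn K (UnionSel K B reps sel) B B' × SplitWin D s t B' k) →
    SplitWin D s t B k
  SplitWin-announceˡ {s} {t} {B} {k} reps white distinct (e , e-inj , in-X) moves .split BX BY BX≗B BY≗B =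
    let b , (b≤k , WY) , replies = uniform-bound (suc s) XReply-antitone XReply-resp reply
    in k ∸ b , b , ≤-reflexive (m∸n+n≡m b≤k) , game (suc s) ≤-refl g g-white g-distinct replies , WY
    where
    g : Fin (suc s) → Fin (n X)
    g = proj₁ ∘ in-X

    reps∘e≗inl∘g : reps ∘ e ≗ inl D ∘ g
    reps∘e≗inl∘g = proj₂ ∘ in-X

    g-white : ∀ j → BX (g j) ≡ false
    g-white j = trans (BX≗B (g j)) (trans (cong B (≡.sym (reps∘e≗inl∘g j))) (white (e j)))

    g-distinct : ∀ i j → i ≢ j → ¬ WhitePath X BX (g i) (g j)
    g-distinct i j i≢j path = distinct (e i) (e j) (i≢j ∘ e-inj)
      (subst₂ (WhitePath K B) (≡.sym (reps∘e≗inl∘g i)) (≡.sym (reps∘e≗inl∘g j)) (WhitePath-inl BX≗B path))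

    XReply : (Fin (suc s) → Bool) → ℕ → Set
    XReply sel b = (∃ λ j → sel j ≡ true) → Reply s X BX g sel (k ∸ b)

    XReply-antitone : ∀ sel {b b'} → b' ≤ b → XReply sel b → XReply sel b'
    XReply-antitone sel b'≤b r = Reply-mono (∸-monoʳ-≤ k b'≤b) ∘ r

    XReply-resp : ∀ {sel sel'} → sel ≗ sel' → ∀ {b} → XReply sel b → XReply sel' b
    XReply-resp sel≗sel' r (j , selected) = Reply-resp sel≗sel' (r (j , trans (sel≗sel' j) selected))

    reply : ∀ sel → ∃ λ b → (b ≤ k × Win t Y BY b) × XReply sel b
    reply sel with any? (λ j → sel j Bool.≟ true)
    ... | yes (j , selected) =
      let b , Y-wins , r = Reply-restrict reps∘e≗inl∘g BX≗B BY≗B e-inj sel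
                             (moves (push e sel) (e j , trans (push-image e-inj j) selected))
      in b , Y-wins , λ _ → r
    -- White never returns an empty choice; it only has to come with some b for which Y wins.
    ... | no empty =
      let b , Y-wins , _ = Reply-restrict reps∘e≗inl∘g BX≗B BY≗B e-inj (λ _ → true)
                             (moves (push e (λ _ → true)) (e zero , push-image e-inj zero))
      in b , Y-wins , λ nonempty → contradiction nonempty empty

win-split : ∀ {K X Y} (D : DisjointUnion K X Y) {s t B k} → Win (s + t) K B k → SplitWin D s t B k
win-split D (done all) .split BX BY BX≗B BY≗B =
  0 , 0 , z≤n , done (λ a → trans (BX≗B a) (all _)) , done (λ b → trans (BY≗B b) (all _))
win-split D (token v white W) with cover D v
... | inj₁ (_ , refl) = SplitWin-tokenˡ D white (win-split D W)
... | inj₂ (_ , refl) =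
  SplitWin-swap (swap D) (SplitWin-tokenˡ (swap D) white (SplitWin-swap D (win-split D W)))
win-split D (force u v F W) with cover D u | cover D v
... | inj₁ (_ , refl) | inj₁ (_ , refl) = SplitWin-forceˡ D F (win-split D W)
... | inj₂ (_ , refl) | inj₂ (_ , refl) =
  SplitWin-swap (swap D) (SplitWin-forceˡ (swap D) F (SplitWin-swap D (win-split D W)))
... | inj₁ (a , refl) | inj₂ (b , refl) = contradiction (ForceIn.uv-adj F) (inl-inr-nonadjacent D a b)
... | inj₂ (b , refl) | inj₁ (a , refl) = contradiction (ForceIn.uv-adj F) (inl-inr-nonadjacent (swap D) b a)
win-split D {s} {t} (game m s+t<m reps white distinct moves)
  with pigeonhole-⊎ s t s+t<m (cover D ∘ reps)
... | inj₁ in-X = SplitWin-announceˡ D reps white distinct in-X λ sel nonempty →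
  let B' , F , W = moves sel nonempty in B' , F , win-split D W
... | inj₂ in-Y = SplitWin-swap (swap D) (SplitWin-announceˡ (swap D) reps white distinct in-Y λ sel nonempty →
  let B' , F , W = moves sel nonempty in B' , F , SplitWin-swap D (win-split D W))

proposition7 : (G H : Graph) (q s t zG zH z : ℕ) → s + t ≡ q →
    IsZ s G zG → IsZ t H zH → IsZ q (G ⊔ H) z → zG + zH ≤ z
proposition7 G H _ s t zG zH z refl (_ , zG-minimal) (_ , zH-minimal) (Black-wins , _) =
  let a , b , a+b≤z , WG , WH =
        win-split (⊔-disjointUnion G H) Black-wins
          .split (allWhite G) (allWhite H) (λ _ → refl) (λ _ → refl)
  in ≤-trans (+-mono-≤ (zG-minimal a WG) (zH-minimal b WH)) a+b≤z
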